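{- For a positive integer $n$ let $\mathscr{A}_n := \left\{ \left\lfloor \frac{n}{k} + 1 \right\rfloor \;;\; k \in \mathbb{N}^*,\ k \le \sqrt{n} \right\} \cap \mathscr{P}$, where $\mathscr{P}$ is the set of prime numbers. Then $$\operatorname{card} \mathscr{A}_n = O\!\left( \sqrt{\frac{n}{\log n}} \right),$$ i.e. there is an absolute constant $C>0$ such that $\operatorname{card}\mathscr{A}_n \le C\sqrt{n/\log n}$ for all sufficiently large positive integers $n$.
   Context: $\log$ is the natural logarithm; $\lfloor\cdot\rfloor$ is the floor function; $\operatorname{card}$ denotes cardinality. -}

module Defs where

open import Data.Nat using (ℕ; zero; suc; _+_; _*_; _≤_; _≤?_)
open import Data.Nat.Properties using (_≟_)
open import Data.Nat.DivMod using (_/_)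
open import Data.Nat.Primality using (prime?)
open import Data.List using (List; map; filter; upTo; length; deduplicate)

-- Indices k = suc j (j < n) with k * k ≤ n, i.e. k ∈ ℕ*, k ≤ √n (note √n ≤ n).
-- ⌊ n / k + 1 ⌋ = ⌊ n / k ⌋ + 1 for k ≥ 1.
-- The set 𝒜ₙ as a duplicate-free list: the values ⌊n/k⌋ + 1 (k admissible) that are prime.
𝒜 : ℕ → List ℕ
𝒜 n = deduplicate _≟_
        (filter prime? (map (λ j → n / suc j + 1) (filter (λ j → suc j * suc j ≤? n) (upTo n))))

card𝒜 : ℕ → ℕ
card𝒜 n = length (𝒜 n)

-- Each prime of 𝒜ₙ is ⌊n/k⌋ + 1 for an index k; if it exceeds X then k ≤ n/X, so
-- card 𝒜ₙ ≤ n/X + π(X) for every X ≥ 1. The primes in (m, 2m] all divide the central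
-- binomial coefficient C(2m, m) ≤ 4^m, so m^(π(2m) − π(m)) ≤ 4^m; summed over dyadic
-- ranges this gives Chebyshev's bound π(2^j)·(j + 1) ≤ 5·2^j. Taking X = 2^j with
-- X² ≈ n log₂ n, both n/X and π(X) are O(√(n / log n)).
module Submission where

open import Level using (Level)
open import Data.Nat
open import Data.Nat.Properties
open import Data.Nat.Divisibility
open import Data.Nat.DivMod
open import Data.Nat.Primality
open import Data.Nat.Combinatorics
open import Data.Nat.ListAction using (product)
open import Data.Nat.Logarithm
open import Data.Nat.Solver using (module +-*-Solver)
open import Data.List using (List; _∷_; _++_; length; map; filter; upTo; applyDownFrom)
open import Data.List.Properties
  using (length-++; length-++-sucʳ; length-map; length-upTo; length-filter; length-applyDownFrom)
open import Data.List.Membership.Propositional using (_∈_)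
open import Data.List.Membership.Propositional.Properties
  using ( ∈-∃++; ∈-++⁻; ∈-++⁺ˡ; ∈-++⁺ʳ; ∈-map⁺; ∈-map⁻; ∈-filter⁺; ∈-filter⁻
        ; ∈-applyDownFrom⁻; ∈-upTo⁺; ∈-deduplicate⁻)
open import Data.List.Relation.Binary.Subset.Propositional using (_⊆_)
open import Data.List.Relation.Unary.Any using (here; there)
open import Data.List.Relation.Unary.All as All using (All; []; _∷_)
open import Data.List.Relation.Unary.AllPairs using ([]; _∷_)
open import Data.List.Relation.Unary.Unique.Propositional using (Unique)
open import Data.List.Relation.Unary.Unique.Propositional.Properties using (filter⁺; applyDownFrom⁺₁)
open import Data.List.Relation.Unary.Unique.DecPropositional.Properties using (deduplicate-!)
open import Data.Product using (∃-syntax; _×_; _,_)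
open import Data.Sum using (inj₁; inj₂)
open import Data.Empty using (⊥-elim)
open import Relation.Nullary using (yes; no)
open import Relation.Binary.PropositionalEquality
open import Defs

private
  variable
    ℓ : Level
    m n o p : ℕ
    ns ps : List ℕ

^-cancelˡ-≤ : ∀ b → 1 < b → b ^ m ≤ b ^ n → m ≤ n
^-cancelˡ-≤ b 1<b bᵐ≤bⁿ = ≮⇒≥ λ n<m → <⇒≱ (^-monoʳ-< b 1<b n<m) bᵐ≤bⁿ

∃b^j≤n<b^[1+j] : ∀ b n → 1 < b → 0 < n → ∃[ j ] b ^ j ≤ n × n < b ^ suc j
∃b^j≤n<b^[1+j] b 1             1<b _ = 0 , ≤-refl , subst (1 <_) (sym (*-identityʳ b)) 1<b
∃b^j≤n<b^[1+j] b (suc (suc n)) 1<b _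
  with j , bʲ≤1+n , 1+n<bʲ⁺¹ ← ∃b^j≤n<b^[1+j] b (suc n) 1<b z<s
  with suc (suc n) ≟ b ^ suc j
... | yes 2+n≡bʲ⁺¹ = suc j , ≤-reflexive (sym 2+n≡bʲ⁺¹)
                   , subst (_< b ^ suc (suc j)) (sym 2+n≡bʲ⁺¹) (^-monoʳ-< b 1<b (n<1+n (suc j)))
... | no  2+n≢bʲ⁺¹ = j , m≤n⇒m≤1+n bʲ≤1+n , ≤∧≢⇒< 1+n<bʲ⁺¹ 2+n≢bʲ⁺¹

2^j*2^j≡4^j : ∀ j → 2 ^ j * 2 ^ j ≡ 4 ^ j
2^j*2^j≡4^j j = begin
  2 ^ j * 2 ^ j  ≡⟨ ^-distribˡ-+-* 2 j j ⟨
  2 ^ (j + j)    ≡⟨ cong (λ k → 2 ^ (j + k)) (+-identityʳ j) ⟨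
  2 ^ (2 * j)    ≡⟨ ^-*-assoc 2 2 j ⟨
  4 ^ j          ∎
  where open ≡-Reasoning

n≤4^k⇒⌊log₂n⌋≤2k : ∀ {n} k → n ≤ 4 ^ k → ⌊log₂ n ⌋ ≤ 2 * k
n≤4^k⇒⌊log₂n⌋≤2k k n≤4ᵏ = subst (_ ≤_) (⌊log₂[2^n]⌋≡n (2 * k))
  (⌊log₂⌋-mono-≤ (subst (_ ≤_) (^-*-assoc 2 2 k) n≤4ᵏ))

m≤n/o⇒o≤n/m : .{{_ : NonZero m}} .{{_ : NonZero o}} → m ≤ n / o → o ≤ n / m
m≤n/o⇒o≤n/m {m} {o} {n} m≤n/o = begin
  o            ≡⟨ m*n/n≡m o m ⟨
  o * m / m    ≤⟨ /-monoˡ-≤ m o*m≤n ⟩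
  n / m        ∎
  where
  open ≤-Reasoning
  o*m≤n : o * m ≤ n
  o*m≤n = begin
    o * m        ≤⟨ *-monoʳ-≤ o m≤n/o ⟩
    o * (n / o)  ≡⟨ *-comm o (n / o) ⟩
    n / o * o    ≤⟨ m/n*n≤m n o ⟩
    n            ∎

[m+n]^2≤4[m^2+n^2] : ∀ m n → (m + n) ^ 2 ≤ 4 * (m ^ 2 + n ^ 2)
[m+n]^2≤4[m^2+n^2] m n = begin
  (m + n) ^ 2        ≤⟨ ^-monoˡ-≤ 2 (+-mono-≤ (m≤m⊔n m n) (m≤n⊔m m n)) ⟩
  (k + k) ^ 2        ≡⟨ solve 1 (λ k → (k :+ k) :^ 2 := con 4 :* k :^ 2) refl k ⟩
  4 * k ^ 2          ≤⟨ *-monoʳ-≤ 4 k²≤m²+n² ⟩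
  4 * (m ^ 2 + n ^ 2) ∎
  where
  open ≤-Reasoning
  open +-*-Solver
  k = m ⊔ n
  k²≤m²+n² : k ^ 2 ≤ m ^ 2 + n ^ 2
  k²≤m²+n² with ⊔-sel m n
  ... | inj₁ k≡m = subst (λ x → x ^ 2 ≤ m ^ 2 + n ^ 2) (sym k≡m) (m≤m+n (m ^ 2) (n ^ 2))
  ... | inj₂ k≡n = subst (λ x → x ^ 2 ≤ m ^ 2 + n ^ 2) (sym k≡n) (m≤n+m (n ^ 2) (m ^ 2))

Unique∧⊆⇒length≤ : {A : Set ℓ} {xs ys : List A} → Unique xs → xs ⊆ ys → length xs ≤ length ys
Unique∧⊆⇒length≤ [] _ = z≤n
Unique∧⊆⇒length≤ {xs = x ∷ xs} (x≢xs ∷ xs!) x∷xs⊆ys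
  with us , vs , refl ← ∈-∃++ (x∷xs⊆ys (here refl)) = begin
    suc (length xs)          ≤⟨ s≤s (Unique∧⊆⇒length≤ xs! xs⊆us++vs) ⟩
    suc (length (us ++ vs))  ≡⟨ length-++-sucʳ us x vs ⟨
    length (us ++ x ∷ vs)    ∎
  where
  open ≤-Reasoning
  xs⊆us++vs : xs ⊆ us ++ vs
  xs⊆us++vs z∈xs with ∈-++⁻ us (x∷xs⊆ys (there z∈xs))
  ... | inj₁ z∈us         = ∈-++⁺ˡ z∈us
  ... | inj₂ (here refl)  = ⊥-elim (All.lookup x≢xs z∈xs refl)
  ... | inj₂ (there z∈vs) = ∈-++⁺ʳ us z∈vs

m^length≤product : All (m ≤_) ns → m ^ length ns ≤ product ns
m^length≤product []           = ≤-refl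
m^length≤product (m≤n ∷ m≤ns) = *-mono-≤ m≤n (m^length≤product m≤ns)

prime∣prime⇒≡ : Prime p → Prime o → p ∣ o → p ≡ o
prime∣prime⇒≡ pp po p∣o with prime⇒irreducible po p∣o
... | inj₁ refl = ⊥-elim (¬prime[1] pp)
... | inj₂ p≡o  = p≡o

prime∣product⇒∈ : Prime p → All Prime ps → p ∣ product ps → p ∈ ps
prime∣product⇒∈ pp [] p∣1 = ⊥-elim (¬prime[1] (subst Prime (∣1⇒≡1 p∣1) pp))
prime∣product⇒∈ {ps = q ∷ qs} pp (pq ∷ pqs) p∣q*qs with euclidsLemma q (product qs) pp p∣q*qs
... | inj₁ p∣q  = here (prime∣prime⇒≡ pp pq p∣q)
... | inj₂ p∣qs = there (prime∣product⇒∈ pp pqs p∣qs)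

distinct-primes⇒product∣ : Unique ps → All Prime ps → All (_∣ n) ps → product ps ∣ n
distinct-primes⇒product∣ [] [] [] = 1∣ _
distinct-primes⇒product∣ {ps = p ∷ qs} (p∉qs ∷ qs!) (pp ∷ pqs) (p∣n ∷ qs∣n)
  with divides t n≡t*qs ← distinct-primes⇒product∣ qs! pqs qs∣n
  with euclidsLemma t (product qs) pp (subst (p ∣_) n≡t*qs p∣n)
... | inj₂ p∣qs = ⊥-elim (All.lookup p∉qs (prime∣product⇒∈ pp pqs p∣qs) refl)
... | inj₁ (divides s refl) = divides s (trans n≡t*qs (*-assoc s p (product qs)))

nCk≤2^n : ∀ n k → n C k ≤ 2 ^ n
nCk≤2^n zero    zero    = ≤-refl
nCk≤2^n zero    (suc k) = z≤n
nCk≤2^n (suc n) zero    = m^n>0 2 (suc n)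
nCk≤2^n (suc n) (suc k) = begin
  suc n C suc k        ≡⟨ nCk+nC[k+1]≡[n+1]C[k+1] n k ⟨
  n C k + n C suc k    ≤⟨ +-mono-≤ (nCk≤2^n n k) (nCk≤2^n n (suc k)) ⟩
  2 ^ n + 2 ^ n        ≡⟨ cong (2 ^ n +_) (+-identityʳ (2 ^ n)) ⟨
  2 ^ suc n            ∎
  where open ≤-Reasoning

prime∣n!⇒p≤n : Prime p → p ∣ n ! → p ≤ n
prime∣n!⇒p≤n {n = zero}  pp p∣1 = ⊥-elim (¬prime[1] (subst Prime (∣1⇒≡1 p∣1) pp))
prime∣n!⇒p≤n {n = suc n} pp p∣n! with euclidsLemma (suc n) (n !) pp p∣n!
... | inj₁ p∣1+n = ∣⇒≤ p∣1+n
... | inj₂ p∣n!  = m≤n⇒m≤1+n (prime∣n!⇒p≤n pp p∣n!)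

m≤n⇒m∣n! : .{{NonZero m}} → m ≤ n → m ∣ n !
m≤n⇒m∣n! {m = suc k} m≤n = ∣-trans (m∣m*n (k !)) (m≤n⇒m!∣n! m≤n)

nCk*[k!*[n∸k]!]≡n! : ∀ {n k} → k ≤ n → (n C k) * (k ! * (n ∸ k) !) ≡ n !
nCk*[k!*[n∸k]!]≡n! {n} {k} k≤n = begin
  (n C k) * (k ! * (n ∸ k) !)                    ≡⟨ cong (_* (k ! * (n ∸ k) !)) (nCk≡n!/k![n-k]! k≤n) ⟩
  (n ! / (k ! * (n ∸ k) !)) * (k ! * (n ∸ k) !)  ≡⟨ m/n*n≡m (k![n∸k]!∣n! k≤n) ⟩
  n !                                            ∎
  where
  open ≡-Reasoning
  instance _ = k !* (n ∸ k) !≢0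

centralBinomial : ℕ → ℕ
centralBinomial m = (m + m) C m

centralBinomial*m!*m!≡[m+m]! : ∀ m → centralBinomial m * (m ! * m !) ≡ (m + m) !
centralBinomial*m!*m!≡[m+m]! m =
  subst (λ k → centralBinomial m * (m ! * k !) ≡ (m + m) !) (m+n∸n≡m m m)
        (nCk*[k!*[n∸k]!]≡n! (m≤n+m m m))

centralBinomial≢0 : ∀ m → NonZero (centralBinomial m)
centralBinomial≢0 m = m*n≢0⇒m≢0 (centralBinomial m)
  {{subst NonZero (sym (centralBinomial*m!*m!≡[m+m]! m)) ((m + m) !≢0)}}

-- p divides (2m)! but, being larger than m, neither factor m! of the denominator.
prime∣centralBinomial : Prime p → m < p → p ≤ m + m → p ∣ centralBinomial m
prime∣centralBinomial {p} {m} pp m<p p≤m+m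
  with euclidsLemma (centralBinomial m) (m ! * m !) pp
         (subst (p ∣_) (sym (centralBinomial*m!*m!≡[m+m]! m)) (m≤n⇒m∣n! {{prime⇒nonZero pp}} p≤m+m))
... | inj₁ p∣C = p∣C
... | inj₂ p∣m!*m! with euclidsLemma (m !) (m !) pp p∣m!*m!
...   | inj₁ p∣m! = ⊥-elim (<⇒≱ m<p (prime∣n!⇒p≤n pp p∣m!))
...   | inj₂ p∣m! = ⊥-elim (<⇒≱ m<p (prime∣n!⇒p≤n pp p∣m!))

interval : ℕ → ℕ → List ℕ
interval a l = applyDownFrom (λ i → a + suc i) l

primesIn : ℕ → ℕ → List ℕ
primesIn a l = filter prime? (interval a l)

π : ℕ → ℕ
π x = length (primesIn 0 x)

length-primesIn : ∀ a l → length (primesIn a l) ≤ l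
length-primesIn a l =
  ≤-trans (length-filter prime? (interval a l)) (≤-reflexive (length-applyDownFrom (λ i → a + suc i) l))

Unique-primesIn : ∀ a l → Unique (primesIn a l)
Unique-primesIn a l = filter⁺ prime? (applyDownFrom⁺₁ (λ i → a + suc i) l λ j<i _ eq →
  <⇒≢ j<i (sym (suc-injective (+-cancelˡ-≡ a _ _ eq))))

∈-primesIn⁻ : ∀ a l → p ∈ primesIn a l → Prime p × a < p × p ≤ a + l
∈-primesIn⁻ a l p∈
  with p∈range , pp ← ∈-filter⁻ prime? {xs = interval a l} p∈
  with i , i<l , refl ← ∈-applyDownFrom⁻ (λ i → a + suc i) p∈range
  = pp , m<m+n a z<s , +-monoʳ-≤ a i<l

∈-interval⁺ : ∀ a l → a < p → p ≤ a + l → p ∈ interval a l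
∈-interval⁺     a zero    a<p p≤a+0 = ⊥-elim (<⇒≱ a<p (subst (_ ≤_) (+-identityʳ a) p≤a+0))
∈-interval⁺ {p} a (suc l) a<p p≤a+1+l with p ≟ a + suc l
... | yes refl    = here refl
... | no  p≢a+1+l = there (∈-interval⁺ a l a<p
      (s≤s⁻¹ (subst (p <_) (+-suc a l) (≤∧≢⇒< p≤a+1+l p≢a+1+l))))

∈-primesIn⁺ : ∀ a l → Prime p → a < p → p ≤ a + l → p ∈ primesIn a l
∈-primesIn⁺ a l pp a<p p≤a+l = ∈-filter⁺ prime? (∈-interval⁺ a l a<p p≤a+l) pp

π[m+n]≤length[primesIn-m-n]+π[m] : ∀ m n → π (m + n) ≤ length (primesIn m n) + π m
π[m+n]≤length[primesIn-m-n]+π[m] m n = begin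
  π (m + n)                                  ≤⟨ Unique∧⊆⇒length≤ (Unique-primesIn 0 (m + n)) split ⟩
  length (primesIn m n ++ primesIn 0 m)      ≡⟨ length-++ (primesIn m n) ⟩
  length (primesIn m n) + π m                ∎
  where
  open ≤-Reasoning
  split : primesIn 0 (m + n) ⊆ primesIn m n ++ primesIn 0 m
  split {p} p∈ with pp , 0<p , p≤m+n ← ∈-primesIn⁻ 0 (m + n) p∈ | p ≤? m
  ... | yes p≤m = ∈-++⁺ʳ (primesIn m n) (∈-primesIn⁺ 0 m pp 0<p p≤m)
  ... | no p≰m  = ∈-++⁺ˡ (∈-primesIn⁺ m n pp (≰⇒> p≰m) p≤m+n)

m^length[primesIn-m-m]≤2^[m+m] : ∀ m → m ^ length (primesIn m m) ≤ 2 ^ (m + m)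
m^length[primesIn-m-m]≤2^[m+m] m = begin
  m ^ length (primesIn m m)  ≤⟨ m^length≤product (All.tabulate (λ p∈ → <⇒≤ (m<p p∈))) ⟩
  product (primesIn m m)     ≤⟨ ∣⇒≤ {{centralBinomial≢0 m}} product∣centralBinomial ⟩
  centralBinomial m          ≤⟨ nCk≤2^n (m + m) m ⟩
  2 ^ (m + m)                ∎
  where
  open ≤-Reasoning
  m<p : ∀ {p} → p ∈ primesIn m m → m < p
  m<p p∈ with _ , m<p , _ ← ∈-primesIn⁻ m m p∈ = m<p
  product∣centralBinomial : product (primesIn m m) ∣ centralBinomial m
  product∣centralBinomial = distinct-primes⇒product∣ (Unique-primesIn m m)
    (All.tabulate λ p∈ → let pp , _ , _ = ∈-primesIn⁻ m m p∈ in pp)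
    (All.tabulate λ p∈ → let pp , m<p , p≤m+m = ∈-primesIn⁻ m m p∈
                         in prime∣centralBinomial pp m<p p≤m+m)

length[primesIn-2^j-2^j]*j≤2^[1+j] : ∀ j → length (primesIn (2 ^ j) (2 ^ j)) * j ≤ 2 ^ j + 2 ^ j
length[primesIn-2^j-2^j]*j≤2^[1+j] j = ^-cancelˡ-≤ 2 (s≤s (s≤s z≤n)) (begin
  2 ^ (c * j)  ≡⟨ cong (2 ^_) (*-comm c j) ⟩
  2 ^ (j * c)  ≡⟨ ^-*-assoc 2 j c ⟨
  x ^ c        ≤⟨ m^length[primesIn-m-m]≤2^[m+m] x ⟩
  2 ^ (x + x)  ∎)
  where
  open ≤-Reasoning
  x = 2 ^ j
  c = length (primesIn x x)

π[2^j]*[1+j]≤5*2^j : ∀ j → π (2 ^ j) * suc j ≤ 5 * 2 ^ j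
π[2^j]*[1+j]≤5*2^j zero    = z≤n
π[2^j]*[1+j]≤5*2^j (suc j) = begin
  π (2 ^ suc j) * (2 + j)                 ≡⟨ cong (λ y → π (x + y) * (2 + j)) (+-identityʳ x) ⟩
  π (x + x) * (2 + j)                     ≤⟨ *-monoˡ-≤ (2 + j) (π[m+n]≤length[primesIn-m-n]+π[m] x x) ⟩
  (c + π x) * (2 + j)                     ≡⟨ solve 3 (λ c π j → (c :+ π) :* (con 2 :+ j)
                                                := c :* j :+ c :+ c :+ (π :* (con 1 :+ j) :+ π)) refl c (π x) j ⟩
  c * j + c + c + (π x * suc j + π x)     ≤⟨ +-mono-≤ (+-mono-≤ (+-mono-≤ c*j≤x+x c≤x) c≤x)
                                                       (+-mono-≤ (π[2^j]*[1+j]≤5*2^j j) (length-primesIn 0 x)) ⟩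
  x + x + x + x + (5 * x + x)             ≡⟨ solve 1 (λ x → x :+ x :+ x :+ x :+ (con 5 :* x :+ x)
                                                := con 5 :* (con 2 :* x)) refl x ⟩
  5 * 2 ^ suc j                           ∎
  where
  open ≤-Reasoning
  open +-*-Solver
  x = 2 ^ j
  c = length (primesIn x x)
  c≤x : c ≤ x
  c≤x = length-primesIn x x
  c*j≤x+x : c * j ≤ x + x
  c*j≤x+x = length[primesIn-2^j-2^j]*j≤2^[1+j] j

-- A value n / k + 1 larger than X forces k ≤ n / X.
card𝒜≤n/X+π[X] : ∀ n X .{{_ : NonZero X}} → card𝒜 n ≤ n / X + π X
card𝒜≤n/X+π[X] n X = begin
  card𝒜 n                                        ≤⟨ Unique∧⊆⇒length≤ (deduplicate-! _≟_ _) 𝒜⊆ ⟩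
  length (map f (upTo (n / X)) ++ primesIn 0 X)  ≡⟨ length-++ (map f (upTo (n / X))) ⟩
  length (map f (upTo (n / X))) + π X            ≡⟨ cong (_+ π X) (length-map f (upTo (n / X))) ⟩
  length (upTo (n / X)) + π X                    ≡⟨ cong (_+ π X) (length-upTo (n / X)) ⟩
  n / X + π X                                    ∎
  where
  open ≤-Reasoning
  f : ℕ → ℕ
  f i = n / suc i + 1
  𝒜⊆ : 𝒜 n ⊆ map f (upTo (n / X)) ++ primesIn 0 X
  𝒜⊆ z∈𝒜
    with z∈values , pz ← ∈-filter⁻ prime? {xs = map f (filter (λ j → suc j * suc j ≤? n) (upTo n))}
                                           (∈-deduplicate⁻ _≟_ _ z∈𝒜)
    with i , _ , refl ← ∈-map⁻ f z∈values
    with f i ≤? X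
  ... | yes fi≤X = ∈-++⁺ʳ (map f (upTo (n / X)))
                     (∈-primesIn⁺ 0 X pz (>-nonZero⁻¹ _ {{prime⇒nonZero pz}}) fi≤X)
  ... | no  fi≰X = ∈-++⁺ˡ (∈-map⁺ f (∈-upTo⁺ (m≤n/o⇒o≤n/m X≤n/[1+i])))
    where
    X≤n/[1+i] : X ≤ n / suc i
    X≤n/[1+i] = ≤-pred (subst (X <_) (+-comm (n / suc i) 1) (≰⇒> fi≰X))

[n/X]^2*L≤4n : ∀ n L X .{{_ : NonZero X}} → n * L ≤ 4 * (X * X) → (n / X) ^ 2 * L ≤ 4 * n
[n/X]^2*L≤4n n L X nL≤4X² = *-cancelʳ-≤ (A ^ 2 * L) (4 * n) (X * X) {{m*n≢0 X X}} (begin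
  A ^ 2 * L * (X * X)  ≡⟨ solve 3 (λ a l x → a :^ 2 :* l :* (x :* x) := a :* x :* (a :* x) :* l) refl A L X ⟩
  A * X * (A * X) * L  ≤⟨ *-monoˡ-≤ L (*-mono-≤ AX≤n AX≤n) ⟩
  n * n * L            ≡⟨ *-assoc n n L ⟩
  n * (n * L)          ≤⟨ *-monoʳ-≤ n nL≤4X² ⟩
  n * (4 * (X * X))    ≡⟨ solve 2 (λ n y → n :* (con 4 :* y) := con 4 :* n :* y) refl n (X * X) ⟩
  4 * n * (X * X)      ∎)
  where
  open ≤-Reasoning
  open +-*-Solver
  A = n / X
  AX≤n : A * X ≤ n
  AX≤n = m/n*n≤m n X

π[2^j]^2*L≤100n : ∀ n L j .{{_ : NonZero L}} → 2 ^ j * 2 ^ j ≤ n * L → L ≤ 2 * suc j →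
                  π (2 ^ j) ^ 2 * L ≤ 100 * n
π[2^j]^2*L≤100n n L j X²≤nL L≤2[1+j] = *-cancelʳ-≤ (B ^ 2 * L) (100 * n) L (begin
  B ^ 2 * L * L          ≡⟨ solve 2 (λ b l → b :^ 2 :* l :* l := b :* l :* (b :* l)) refl B L ⟩
  B * L * (B * L)        ≤⟨ *-mono-≤ BL≤10X BL≤10X ⟩
  10 * X * (10 * X)      ≡⟨ solve 1 (λ x → con 10 :* x :* (con 10 :* x) := con 100 :* (x :* x)) refl X ⟩
  100 * (X * X)          ≤⟨ *-monoʳ-≤ 100 X²≤nL ⟩
  100 * (n * L)          ≡⟨ *-assoc 100 n L ⟨
  100 * n * L            ∎)
  where
  open ≤-Reasoning
  open +-*-Solver
  X = 2 ^ j
  B = π X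
  BL≤10X : B * L ≤ 10 * X
  BL≤10X = begin
    B * L              ≤⟨ *-monoʳ-≤ B L≤2[1+j] ⟩
    B * (2 * suc j)    ≡⟨ solve 2 (λ b k → b :* (con 2 :* k) := con 2 :* (b :* k)) refl B (suc j) ⟩
    2 * (B * suc j)    ≤⟨ *-monoʳ-≤ 2 (π[2^j]*[1+j]≤5*2^j j) ⟩
    2 * (5 * X)        ≡⟨ *-assoc 2 5 X ⟨
    10 * X             ∎

card𝒜^2*⌊log₂n⌋≤416n : ∀ n j .{{_ : NonZero ⌊log₂ n ⌋}} →
                        4 ^ j ≤ n * ⌊log₂ n ⌋ → n * ⌊log₂ n ⌋ < 4 ^ suc j →
                        card𝒜 n ^ 2 * ⌊log₂ n ⌋ ≤ 416 * n
card𝒜^2*⌊log₂n⌋≤416n n j 4ʲ≤nL nL<4ʲ⁺¹ = begin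
  card𝒜 n ^ 2 * L                      ≤⟨ *-monoˡ-≤ L (^-monoˡ-≤ 2 (card𝒜≤n/X+π[X] n X)) ⟩
  (n / X + π X) ^ 2 * L                ≤⟨ *-monoˡ-≤ L ([m+n]^2≤4[m^2+n^2] (n / X) (π X)) ⟩
  4 * ((n / X) ^ 2 + π X ^ 2) * L      ≡⟨ solve 3 (λ a b l → con 4 :* (a :+ b) :* l
                                                := con 4 :* (a :* l :+ b :* l)) refl ((n / X) ^ 2) (π X ^ 2) L ⟩
  4 * ((n / X) ^ 2 * L + π X ^ 2 * L)  ≤⟨ *-monoʳ-≤ 4 (+-mono-≤ ([n/X]^2*L≤4n n L X nL≤4X²)
                                                                (π[2^j]^2*L≤100n n L j X²≤nL L≤2[1+j])) ⟩
  4 * (4 * n + 100 * n)                ≡⟨ solve 1 (λ n → con 4 :* (con 4 :* n :+ con 100 :* n)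
                                                := con 416 :* n) refl n ⟩
  416 * n                              ∎
  where
  open ≤-Reasoning
  open +-*-Solver
  L = ⌊log₂ n ⌋
  X = 2 ^ j
  instance _ = m^n≢0 2 j
  X²≤nL : X * X ≤ n * L
  X²≤nL = subst (_≤ n * L) (sym (2^j*2^j≡4^j j)) 4ʲ≤nL
  nL≤4X² : n * L ≤ 4 * (X * X)
  nL≤4X² = subst (λ y → n * L ≤ 4 * y) (sym (2^j*2^j≡4^j j)) (<⇒≤ nL<4ʲ⁺¹)
  L≤2[1+j] : L ≤ 2 * suc j
  L≤2[1+j] = n≤4^k⇒⌊log₂n⌋≤2k (suc j) (≤-trans (m≤m*n n L) (<⇒≤ nL<4ʲ⁺¹))

proposition9 : ∃[ C ] ∃[ N ] ∀ (n : ℕ) → N ≤ n →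
                 (card𝒜 n) ^ 2 * ⌊log₂ n ⌋ ≤ C * n
proposition9 = 416 , 2 , λ n 2≤n →
  let instance
        log₂n≢0 : NonZero ⌊log₂ n ⌋
        log₂n≢0 = >-nonZero (⌊log₂⌋-mono-≤ 2≤n)
      0<n*log₂n = <-≤-trans z<s (≤-trans 2≤n (m≤m*n n ⌊log₂ n ⌋))
      j , 4ʲ≤nL , nL<4ʲ⁺¹ = ∃b^j≤n<b^[1+j] 4 (n * ⌊log₂ n ⌋) (s≤s (s≤s z≤n)) 0<n*log₂n
  in card𝒜^2*⌊log₂n⌋≤416n n j 4ʲ≤nL nL<4ʲ⁺¹
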